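{- Let $m\ge 0$ and let $T_m$ be the thread of order $m$. (a) The thread $T_0$ has exactly three prestar labellings with exponent $w_{\mathbf 2}$, namely those of types $(2,0)$, $(0,2)$ and $(1,1)$. (b) For $m\ge 1$, $T_m$ has exactly two $1$-footed prestar labellings with exponent $w_{\mathbf 2}$, one of type $(2,0)$ and one of type $(0,2)$. (c) Let $m\ge1$ and $(i,j)\in\{(1,1),(2,0),(0,2)\}$ with $(m,i,j)\ne(1,0,2)$. Then $T_m$ has exactly one $1$-footed prestar labelling with exponent $w_{ij}$, and it has type $(i,j)$. (d) For $m=1$, $T_1$ has exactly two $1$-footed prestar labellings with exponent $w_{02}$: one of type $(0,2)$ and one of type $(1,1)$.
   Context: For $m\ge0$, the thread $T_m$ is the graph obtained from a path $v_0e_0v_1e_1\cdots e_mv_{m+1}$ (so $e_k=v_kv_{k+1}$) by adding new vertices $w_k$ and edges $f_k=v_kw_k$ for $1\le k\le m$. A flag is an incident pair $(v,e)$ of a vertex and an edge, written $ve$. A prestar labelling of $T_m$ is a function $\pi$ from the set of flags of $T_m$ to $\{0,1,2\}$ such that for each $1\le k\le m$ the three values $\pi(v_ke_{k-1}),\pi(v_ke_k),\pi(v_kf_k)$ are $0,1,2$ in some order. Its exponent is the edge weighting $e=uv\mapsto \pi(ue)+\pi(ve)$. It is $1$-footed if $\pi(w_kf_k)=1$ for all $1\le k\le m$, and has type $(i,j)$ if $\pi(v_0e_0)=i$ and $\pi(v_{m+1}e_m)=j$. Edge weightings of $T_m$: $w_{\mathbf 2}$ is constantly $2$. For $m\ge1$: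 $w_{11}(e_0)=1$, $w_{11}(e_m)=3$, and $w_{11}=2$ elsewhere; $w_{02}(e_0)=1$, $w_{02}(f_1)=3$, and $w_{02}=2$ elsewhere; $w_{20}(e_0)=3$, $w_{20}(e_1)=0$, $w_{20}(f_1)=3$, and $w_{20}=2$ elsewhere. -}

module Defs where

open import Data.Nat using (ℕ; zero; suc; _+_; _≡ᵇ_)
open import Data.Bool using (if_then_else_)
open import Data.Fin using (Fin; zero; suc; toℕ; fromℕ; inject₁; #_)
open import Data.Product using (_×_; Σ-syntax)
open import Data.Sum using (_⊎_)
open import Relation.Binary.PropositionalEquality using (_≡_; _≢_)

-- Vertices v_0..v_{m+1}, w_1..w_m.
-- Edges: e_k = v_k v_{k+1} (0 ≤ k ≤ m), f_k = v_k w_k (1 ≤ k ≤ m).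
-- Index convention: e_k ↦ eE k (k : Fin (suc m));  f_k ↦ fE i with k = i + 1 (i : Fin m).
data Edge (m : ℕ) : Set where
  eE : Fin (suc m) → Edge m
  fE : Fin m → Edge m

-- Flags (incident vertex–edge pairs) of T_m; every edge has exactly two flags.
--   vL k  = flag v_k e_k        (k : Fin (suc m))
--   vR k  = flag v_{k+1} e_k    (k : Fin (suc m))
--   vF i  = flag v_k f_k        (k = i + 1)
--   wF i  = flag w_k f_k        (k = i + 1)
data Flag (m : ℕ) : Set where
  vL vR : Fin (suc m) → Flag m
  vF wF : Fin m → Flag m

Labelling : ℕ → Set
Labelling m = Flag m → Fin 3

Perm012 : Fin 3 → Fin 3 → Fin 3 → Set
Perm012 a b c = (a ≢ b) × (a ≢ c) × (b ≢ c)

-- Prestar condition: for each 1 ≤ k ≤ m (k = i + 1),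
-- π(v_k e_{k-1}), π(v_k e_k), π(v_k f_k) are 0,1,2 in some order.
IsPrestar : (m : ℕ) → Labelling m → Set
IsPrestar m π = (i : Fin m) → Perm012 (π (vR (inject₁ i))) (π (vL (suc i))) (π (vF i))

exponent : (m : ℕ) → Labelling m → Edge m → ℕ
exponent m π (eE k) = toℕ (π (vL k)) + toℕ (π (vR k))
exponent m π (fE i) = toℕ (π (vF i)) + toℕ (π (wF i))

HasExponent : (m : ℕ) → Labelling m → (Edge m → ℕ) → Set
HasExponent m π w = (e : Edge m) → exponent m π e ≡ w e

OneFooted : (m : ℕ) → Labelling m → Set
OneFooted m π = (i : Fin m) → π (wF i) ≡ # 1

HasType : (m : ℕ) → Labelling m → Fin 3 → Fin 3 → Set
HasType m π i j = (π (vL zero) ≡ i) × (π (vR (fromℕ m)) ≡ j)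

_≐_ : {m : ℕ} → Labelling m → Labelling m → Set
π ≐ ρ = ∀ f → π f ≡ ρ f

w𝟐 : (m : ℕ) → Edge m → ℕ
w𝟐 m e = 2

-- The following are for T_m with m = suc n ≥ 1.
-- w11: e_0 ↦ 1, e_m ↦ 3, else 2
w11 : (n : ℕ) → Edge (suc n) → ℕ
w11 n (eE k) with toℕ k
... | zero = 1
... | suc j = if j ≡ᵇ n then 3 else 2
w11 n (fE i) = 2

-- w02: e_0 ↦ 1, f_1 ↦ 3, else 2
w02 : (n : ℕ) → Edge (suc n) → ℕ
w02 n (eE k) = if toℕ k ≡ᵇ 0 then 1 else 2
w02 n (fE i) = if toℕ i ≡ᵇ 0 then 3 else 2

-- w20: e_0 ↦ 3, e_1 ↦ 0, f_1 ↦ 3, else 2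
w20 : (n : ℕ) → Edge (suc n) → ℕ
w20 n (eE k) with toℕ k
... | 0 = 3
... | 1 = 0
... | _ = 2
w20 n (fE i) = if toℕ i ≡ᵇ 0 then 3 else 2

Good : (m : ℕ) → (Edge m → ℕ) → Labelling m → Set
Good m w π = IsPrestar m π × HasExponent m π w

Good1 : (m : ℕ) → (Edge m → ℕ) → Labelling m → Set
Good1 m w π = IsPrestar m π × OneFooted m π × HasExponent m π w

UniqueOfType : (m : ℕ) → (Labelling m → Set) → Fin 3 → Fin 3 → Set
UniqueOfType m P i j =
  Σ[ π ∈ Labelling m ] (P π × HasType m π i j × (∀ ρ → P ρ → ρ ≐ π))

-- "exactly two labellings with property P, of types (i₁,j₁) and (i₂,j₂)"
-- (the two types given are distinct in all uses, so the two labellings are distinct)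
TwoOfTypes : (m : ℕ) → (Labelling m → Set) → Fin 3 → Fin 3 → Fin 3 → Fin 3 → Set
TwoOfTypes m P i₁ j₁ i₂ j₂ =
  Σ[ π₁ ∈ Labelling m ] Σ[ π₂ ∈ Labelling m ]
    (P π₁ × HasType m π₁ i₁ j₁ × P π₂ × HasType m π₂ i₂ j₂ ×
     (∀ ρ → P ρ → (ρ ≐ π₁) ⊎ (ρ ≐ π₂)))

ThreeOfTypes : (m : ℕ) → (Labelling m → Set) →
               Fin 3 → Fin 3 → Fin 3 → Fin 3 → Fin 3 → Fin 3 → Set
ThreeOfTypes m P i₁ j₁ i₂ j₂ i₃ j₃ =
  Σ[ π₁ ∈ Labelling m ] Σ[ π₂ ∈ Labelling m ] Σ[ π₃ ∈ Labelling m ]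
    (P π₁ × HasType m π₁ i₁ j₁ × P π₂ × HasType m π₂ i₂ j₂ × P π₃ × HasType m π₃ i₃ j₃ ×
     (∀ ρ → P ρ → (ρ ≐ π₁) ⊎ ((ρ ≐ π₂) ⊎ (ρ ≐ π₃))))

-- A prestar labelling with a given exponent is determined by its foot labels and
-- by π(v₀e₀): the exponent of eₖ turns π(vₖeₖ) into π(vₖ₊₁eₖ), and the prestar
-- condition at vₖ₊₁, whose three labels sum to 0 + 1 + 2, then gives π(vₖ₊₁eₖ₊₁).
-- For 1-footed labellings the foot labels are fixed by the exponents of the fₖ,
-- so it only remains to find the admissible values of π(v₀e₀), which local
-- constraints at e₀, v₁ (and, for w₀₂ with m ≥ 2, at e₁ and v₂) pin down, and to
-- exhibit a labelling for each of them.
module Submission where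

open import Defs
open import Data.Bool using (true; false; T; if_then_else_)
open import Data.Empty using (⊥-elim)
open import Data.Fin using (Fin; zero; suc; toℕ; inject₁; #_)
open import Data.Fin.Induction using (<-weakInduction)
open import Data.Fin.Properties using (toℕ-injective; toℕ-fromℕ; toℕ-inject₁-≢; all?; _≟_)
open import Data.Nat using (ℕ; zero; suc; _+_; _≡ᵇ_)
open import Data.Nat.Properties using (+-cancelˡ-≡; +-cancelʳ-≡; suc-injective; ≡ᵇ⇒≡; ≡⇒≡ᵇ)
  renaming (_≟_ to _≟ℕ_)
open import Data.Product using (_×_; _,_; proj₁; proj₂)
open import Data.Sum using (_⊎_; inj₁; inj₂)
open import Function using (_∘_)
open import Relation.Nullary using (¬_)
open import Relation.Nullary.Decidable using (from-yes; ¬?; _×-dec_; _→-dec_)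
open import Relation.Binary.PropositionalEquality using (_≡_; _≢_; refl; sym; trans; subst)

private
  variable
    m n : ℕ
    w : Edge m → ℕ
    a b c a′ b′ c′ x y : Fin 3
    ρ π : Labelling m

perm012-sum : ∀ a b c → Perm012 a b c → toℕ a + toℕ b + toℕ c ≡ 3
perm012-sum = from-yes (all? {n = 3} λ a → all? λ b → all? λ c →
  (¬? (a ≟ b) ×-dec ¬? (a ≟ c) ×-dec ¬? (b ≟ c)) →-dec (toℕ a + toℕ b + toℕ c ≟ℕ 3))

+-cancelˡ-toℕ : toℕ a + toℕ b ≡ toℕ a′ + toℕ b′ → a ≡ a′ → b ≡ b′
+-cancelˡ-toℕ {a} eq refl = toℕ-injective (+-cancelˡ-≡ (toℕ a) _ _ eq)

+-cancelʳ-toℕ : toℕ a + toℕ b ≡ toℕ a′ + toℕ b′ → b ≡ b′ → a ≡ a′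
+-cancelʳ-toℕ {b = b} eq refl = toℕ-injective (+-cancelʳ-≡ (toℕ b) _ _ eq)

perm012-middle : Perm012 a b c → Perm012 a′ b′ c′ → a ≡ a′ → c ≡ c′ → b ≡ b′
perm012-middle {a} {b} {c} {b′ = b′} p p′ refl refl =
  +-cancelˡ-toℕ (+-cancelʳ-≡ (toℕ c) _ _ sums≡) refl
  where
  sums≡ : toℕ a + toℕ b + toℕ c ≡ toℕ a + toℕ b′ + toℕ c
  sums≡ = trans (perm012-sum a b c p) (sym (perm012-sum a b′ c p′))

decompose₁ : toℕ a + toℕ b ≡ 1 → (a ≡ # 0 × b ≡ # 1) ⊎ (a ≡ # 1 × b ≡ # 0)
decompose₁ {zero} eq = inj₁ (refl , toℕ-injective eq)
decompose₁ {suc zero} eq = inj₂ (refl , toℕ-injective (suc-injective eq))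

decompose₂ : toℕ a + toℕ b ≡ 2 →
  (a ≡ # 0 × b ≡ # 2) ⊎ (a ≡ # 1 × b ≡ # 1) ⊎ (a ≡ # 2 × b ≡ # 0)
decompose₂ {zero} eq = inj₁ (refl , toℕ-injective eq)
decompose₂ {suc zero} eq = inj₂ (inj₁ (refl , toℕ-injective (suc-injective eq)))
decompose₂ {suc (suc zero)} eq = inj₂ (inj₂ (refl , toℕ-injective (suc-injective (suc-injective eq))))

decompose₃ : toℕ a + toℕ b ≡ 3 → (a ≡ # 1 × b ≡ # 2) ⊎ (a ≡ # 2 × b ≡ # 1)
decompose₃ {zero} {zero} ()
decompose₃ {zero} {suc zero} ()
decompose₃ {zero} {suc (suc zero)} ()
decompose₃ {suc zero} eq = inj₁ (refl , toℕ-injective (suc-injective eq))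
decompose₃ {suc (suc zero)} eq = inj₂ (refl , toℕ-injective (suc-injective (suc-injective eq)))

if-T : ∀ {A : Set} {b} {x y : A} → T b → (if b then x else y) ≡ x
if-T {b = true} _ = refl

if-¬T : ∀ {A : Set} {b} {x y : A} → ¬ T b → (if b then x else y) ≡ y
if-¬T {b = false} _ = refl
if-¬T {b = true} ¬t = ⊥-elim (¬t _)

prestar-determined : Good m w ρ → Good m w π →
  (∀ i → ρ (vF i) ≡ π (vF i)) → (∀ i → ρ (wF i) ≡ π (wF i)) →
  ρ (vL zero) ≡ π (vL zero) → ρ ≐ π
prestar-determined {ρ = ρ} {π = π} (ρ-prestar , ρ-exp) (π-prestar , π-exp) vF≡ wF≡ start≡ = agree
  where
  across : ∀ k → ρ (vL k) ≡ π (vL k) → ρ (vR k) ≡ π (vR k)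
  across k = +-cancelˡ-toℕ (trans (ρ-exp (eE k)) (sym (π-exp (eE k))))

  through : ∀ i → ρ (vR (inject₁ i)) ≡ π (vR (inject₁ i)) → ρ (vL (suc i)) ≡ π (vL (suc i))
  through i eq = perm012-middle (ρ-prestar i) (π-prestar i) eq (vF≡ i)

  outgoing : ∀ k → ρ (vL k) ≡ π (vL k)
  outgoing = <-weakInduction _ start≡ (λ i → through i ∘ across (inject₁ i))

  agree : ρ ≐ π
  agree (vL k) = outgoing k
  agree (vR k) = across k (outgoing k)
  agree (vF i) = vF≡ i
  agree (wF i) = wF≡ i

foot-exponent : Good1 m w ρ → ∀ i → toℕ (ρ (vF i)) + 1 ≡ w (fE i)
foot-exponent {w = w} {ρ = ρ} (_ , footed , exp) i =
  subst (λ f → toℕ (ρ (vF i)) + toℕ f ≡ w (fE i)) (footed i) (exp (fE i))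

foot-label : Good1 m w ρ → ∀ {i} x → toℕ x + 1 ≡ w (fE i) → ρ (vF i) ≡ x
foot-label g {i} x eq = toℕ-injective (+-cancelʳ-≡ 1 _ _ (trans (foot-exponent g i) (sym eq)))

footed-determined : Good1 m w ρ → Good1 m w π → ρ (vL zero) ≡ π (vL zero) → ρ ≐ π
footed-determined gρ@(ρ-prestar , ρ-footed , ρ-exp) gπ@(π-prestar , π-footed , π-exp) =
  prestar-determined (ρ-prestar , ρ-exp) (π-prestar , π-exp)
    (λ i → foot-label gρ _ (foot-exponent gπ i)) (λ i → trans (ρ-footed i) (sym (π-footed i)))

incoming≢foot : Good1 m w ρ → ∀ i x → toℕ x + 1 ≡ w (fE i) → ρ (vR (inject₁ i)) ≢ x
incoming≢foot g@(prestar , _) i x eq in≡x =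
  proj₁ (proj₂ (prestar i)) (trans in≡x (sym (foot-label g x eq)))

outgoing≢foot : Good1 m w ρ → ∀ i x → toℕ x + 1 ≡ w (fE i) → ρ (vL (suc i)) ≢ x
outgoing≢foot g@(prestar , _) i x eq out≡x =
  proj₂ (proj₂ (prestar i)) (trans out≡x (sym (foot-label g x eq)))

unique-of-start : ∀ {i j} → Good1 m w π → HasType m π i j →
  (∀ {ρ} → Good1 m w ρ → ρ (vL zero) ≡ π (vL zero)) → UniqueOfType m (Good1 m w) i j
unique-of-start {π = π} gπ type start = π , gπ , type , λ ρ gρ → footed-determined gρ gπ (start gρ)

two-of-starts : ∀ {π₁ π₂ i₁ j₁ i₂ j₂} →
  Good1 m w π₁ → HasType m π₁ i₁ j₁ → Good1 m w π₂ → HasType m π₂ i₂ j₂ →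
  (∀ {ρ} → Good1 m w ρ → ρ (vL zero) ≡ π₁ (vL zero) ⊎ ρ (vL zero) ≡ π₂ (vL zero)) →
  TwoOfTypes m (Good1 m w) i₁ j₁ i₂ j₂
two-of-starts {π₁ = π₁} {π₂} g₁ type₁ g₂ type₂ start = π₁ , π₂ , g₁ , type₁ , g₂ , type₂ , classify
  where
  classify : ∀ ρ → Good1 _ _ ρ → (ρ ≐ π₁) ⊎ (ρ ≐ π₂)
  classify ρ g with start g
  ... | inj₁ eq = inj₁ (footed-determined g g₁ eq)
  ... | inj₂ eq = inj₂ (footed-determined g g₂ eq)

uniform : Fin 3 → Fin 3 → Labelling m
uniform x y (vL _) = x
uniform x y (vR _) = y
uniform x y (vF _) = # 1
uniform x y (wF _) = # 1

uniform-exponent : toℕ x + toℕ y ≡ 2 → HasExponent m (uniform x y) (w𝟐 m)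
uniform-exponent eq (eE _) = eq
uniform-exponent eq (fE _) = refl

uniform-good1 : toℕ x + toℕ y ≡ 2 → Perm012 y x (# 1) → Good1 m (w𝟐 m) (uniform x y)
uniform-good1 eq perm = (λ _ → perm) , (λ _ → refl) , uniform-exponent eq

w11-witness : (n : ℕ) → Labelling (suc n)
w11-witness n (vL zero) = # 1
w11-witness n (vL (suc _)) = # 2
w11-witness n (vR k) = if toℕ k ≡ᵇ suc n then # 1 else # 0
w11-witness n (vF _) = # 1
w11-witness n (wF _) = # 1

w11-witness-good1 : Good1 (suc n) (w11 n) (w11-witness n)
w11-witness-good1 {n} = prestar , (λ _ → refl) , weights
  where
  prestar : IsPrestar (suc n) (w11-witness n)
  prestar i = subst (λ y → Perm012 y (# 2) (# 1))
    (sym (if-¬T (toℕ-inject₁-≢ i ∘ sym ∘ ≡ᵇ⇒≡ _ _))) ((λ ()) , (λ ()) , (λ ()))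

  weights : HasExponent (suc n) (w11-witness n) (w11 n)
  weights (eE zero) = refl
  weights (eE (suc k)) with toℕ k ≡ᵇ n
  ... | true = refl
  ... | false = refl
  weights (fE _) = refl

w11-witness-type : HasType (suc n) (w11-witness n) (# 1) (# 1)
w11-witness-type {n} = refl , if-T (≡⇒≡ᵇ _ _ (toℕ-fromℕ n))

w20-witness : (n : ℕ) → Labelling (suc n)
w20-witness n (vL (suc zero)) = # 0
w20-witness n (vL _) = # 2
w20-witness n (vR zero) = # 1
w20-witness n (vR (suc _)) = # 0
w20-witness n (vF zero) = # 2
w20-witness n (vF (suc _)) = # 1
w20-witness n (wF _) = # 1

w20-witness-good1 : Good1 (suc n) (w20 n) (w20-witness n)
w20-witness-good1 {n} = prestar , (λ _ → refl) , weights
  where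
  prestar : IsPrestar (suc n) (w20-witness n)
  prestar zero = (λ ()) , (λ ()) , (λ ())
  prestar (suc _) = (λ ()) , (λ ()) , (λ ())

  weights : HasExponent (suc n) (w20-witness n) (w20 n)
  weights (eE zero) = refl
  weights (eE (suc zero)) = refl
  weights (eE (suc (suc _))) = refl
  weights (fE zero) = refl
  weights (fE (suc _)) = refl

w02-witness : (n : ℕ) → Labelling (suc n)
w02-witness n (vL _) = # 0
w02-witness n (vR zero) = # 1
w02-witness n (vR (suc _)) = # 2
w02-witness n (vF zero) = # 2
w02-witness n (vF (suc _)) = # 1
w02-witness n (wF _) = # 1

w02-witness-good1 : Good1 (suc n) (w02 n) (w02-witness n)
w02-witness-good1 {n} = prestar , (λ _ → refl) , weights
  where
  prestar : IsPrestar (suc n) (w02-witness n)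
  prestar zero = (λ ()) , (λ ()) , (λ ())
  prestar (suc _) = (λ ()) , (λ ()) , (λ ())

  weights : HasExponent (suc n) (w02-witness n) (w02 n)
  weights (eE zero) = refl
  weights (eE (suc _)) = refl
  weights (fE zero) = refl
  weights (fE (suc _)) = refl

w02-witness₁₁ : Labelling 1
w02-witness₁₁ (vL _) = # 1
w02-witness₁₁ (vR zero) = # 0
w02-witness₁₁ (vR (suc _)) = # 1
w02-witness₁₁ (vF _) = # 2
w02-witness₁₁ (wF _) = # 1

w02-witness₁₁-good1 : Good1 1 (w02 0) w02-witness₁₁
w02-witness₁₁-good1 = prestar , (λ _ → refl) , weights
  where
  prestar : IsPrestar 1 w02-witness₁₁
  prestar zero = (λ ()) , (λ ()) , (λ ())

  weights : HasExponent 1 w02-witness₁₁ (w02 0)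
  weights (eE zero) = refl
  weights (eE (suc zero)) = refl
  weights (fE zero) = refl

-- In the start lemmas a = π(v₀e₀) and b = π(v₁e₀); for w₀₂ also d = π(v₁e₁) and b′ = π(v₂e₁).

w𝟐-start : Good1 (suc n) (w𝟐 (suc n)) ρ → ρ (vL zero) ≡ # 2 ⊎ ρ (vL zero) ≡ # 0
w𝟐-start g@(_ , _ , exp) with decompose₂ (exp (eE zero))
... | inj₁ (a≡0 , _) = inj₂ a≡0
... | inj₂ (inj₁ (_ , b≡1)) = ⊥-elim (incoming≢foot g zero (# 1) refl b≡1)
... | inj₂ (inj₂ (a≡2 , _)) = inj₁ a≡2

w11-start : Good1 (suc n) (w11 n) ρ → ρ (vL zero) ≡ # 1
w11-start g@(_ , _ , exp) with decompose₁ (exp (eE zero))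
... | inj₁ (_ , b≡1) = ⊥-elim (incoming≢foot g zero (# 1) refl b≡1)
... | inj₂ (a≡1 , _) = a≡1

w20-start : Good1 (suc n) (w20 n) ρ → ρ (vL zero) ≡ # 2
w20-start g@(_ , _ , exp) with decompose₃ (exp (eE zero))
... | inj₁ (_ , b≡2) = ⊥-elim (incoming≢foot g zero (# 2) refl b≡2)
... | inj₂ (a≡2 , _) = a≡2

w02-start : Good1 (suc (suc n)) (w02 (suc n)) ρ → ρ (vL zero) ≡ # 0
w02-start g@(prestar , _ , exp) with decompose₂ (exp (eE (suc zero)))
... | inj₂ (inj₁ (_ , b′≡1)) = ⊥-elim (incoming≢foot g (suc zero) (# 1) refl b′≡1)
... | inj₂ (inj₂ (d≡2 , _)) = ⊥-elim (outgoing≢foot g zero (# 2) refl d≡2)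
... | inj₁ (d≡0 , _) with decompose₁ (exp (eE zero))
...   | inj₁ (a≡0 , _) = a≡0
...   | inj₂ (_ , b≡0) = ⊥-elim (proj₁ (prestar zero) (trans b≡0 (sym d≡0)))

w02-start₁ : Good1 1 (w02 0) ρ → ρ (vL zero) ≡ # 0 ⊎ ρ (vL zero) ≡ # 1
w02-start₁ (_ , _ , exp) with decompose₁ (exp (eE zero))
... | inj₁ (a≡0 , _) = inj₁ a≡0
... | inj₂ (a≡1 , _) = inj₂ a≡1

w𝟐-on-T₀ : ThreeOfTypes 0 (Good 0 (w𝟐 0)) (# 2) (# 0) (# 0) (# 2) (# 1) (# 1)
w𝟐-on-T₀ = uniform (# 2) (# 0) , uniform (# 0) (# 2) , uniform (# 1) (# 1)
  , good refl , (refl , refl) , good refl , (refl , refl) , good refl , (refl , refl) , classify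
  where
  good : toℕ x + toℕ y ≡ 2 → Good 0 (w𝟐 0) (uniform x y)
  good eq = (λ ()) , uniform-exponent eq

  same-start : Good 0 (w𝟐 0) ρ → toℕ x + toℕ y ≡ 2 → ρ (vL zero) ≡ x → ρ ≐ uniform x y
  same-start g eq = prestar-determined g (good eq) (λ ()) (λ ())

  classify : ∀ ρ → Good 0 (w𝟐 0) ρ →
    (ρ ≐ uniform (# 2) (# 0)) ⊎ (ρ ≐ uniform (# 0) (# 2)) ⊎ (ρ ≐ uniform (# 1) (# 1))
  classify ρ g@(_ , exp) with decompose₂ (exp (eE zero))
  ... | inj₁ (a≡0 , _) = inj₂ (inj₁ (same-start g refl a≡0))
  ... | inj₂ (inj₁ (a≡1 , _)) = inj₂ (inj₂ (same-start g refl a≡1))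
  ... | inj₂ (inj₂ (a≡2 , _)) = inj₁ (same-start g refl a≡2)

lemma3p1 : ThreeOfTypes 0 (Good 0 (w𝟐 0)) (# 2) (# 0) (# 0) (# 2) (# 1) (# 1)
    × (∀ (n : ℕ) → TwoOfTypes (suc n) (Good1 (suc n) (w𝟐 (suc n))) (# 2) (# 0) (# 0) (# 2))
    × (∀ (n : ℕ) → UniqueOfType (suc n) (Good1 (suc n) (w11 n)) (# 1) (# 1))
    × (∀ (n : ℕ) → UniqueOfType (suc n) (Good1 (suc n) (w20 n)) (# 2) (# 0))
    × (∀ (n : ℕ) → UniqueOfType (suc (suc n)) (Good1 (suc (suc n)) (w02 (suc n))) (# 0) (# 2))
    × TwoOfTypes 1 (Good1 1 (w02 0)) (# 0) (# 2) (# 1) (# 1)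
lemma3p1 =
    w𝟐-on-T₀
  , (λ _ → two-of-starts (uniform-good1 refl ((λ ()) , (λ ()) , (λ ()))) (refl , refl)
                         (uniform-good1 refl ((λ ()) , (λ ()) , (λ ()))) (refl , refl) w𝟐-start)
  , (λ n → unique-of-start w11-witness-good1 (w11-witness-type {n}) w11-start)
  , (λ _ → unique-of-start w20-witness-good1 (refl , refl) w20-start)
  , (λ _ → unique-of-start w02-witness-good1 (refl , refl) w02-start)
  , two-of-starts w02-witness-good1 (refl , refl) w02-witness₁₁-good1 (refl , refl) w02-start₁
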